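{- Let $m\in\mathbb N$ and let $f:\mathbb Z\to\mathbb R_{\ge0}$ with $f(1)=0$ be such that $f(x)=0$ for $-m+2\le x\le1$ and $f(x)>0$ for all other $x\in\mathbb Z$. Then there exists a function $r:\mathbb Z\to\mathbb R_{\ge0}$ with $r(1)=0$ such that for all $x\in\mathbb Z$, $$f(x)=\Big(\prod_{i=0}^{m-1}r(x+i)\Big)^{1/m}.$$ -}

module Defs where

open import Level using (0ℓ)
open import Data.Nat using (ℕ; zero; suc)
open import Data.Product using (Σ; ∃; _×_)
open import Data.Sum using () renaming (_⊎_ to _⊎′_)
open import Relation.Nullary using (¬_)
open import Algebra.Bundles using (CommutativeRing)

-- The real numbers, axiomatised as a complete ordered field
-- (any two models are isomorphic, so quantifying over all models
-- is the same as speaking about ℝ).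
record RealField : Set₁ where
  field
    commutativeRing : CommutativeRing 0ℓ 0ℓ
  open CommutativeRing commutativeRing public
  field
    0≉1     : ¬ (0# ≈ 1#)
    inverse : ∀ x → ¬ (x ≈ 0#) → Σ Carrier (λ y → x * y ≈ 1#)
    _≤_        : Carrier → Carrier → Set
    ≤-resp-≈   : ∀ {x x′ y y′} → x ≈ x′ → y ≈ y′ → x ≤ y → x′ ≤ y′
    ≤-refl     : ∀ {x} → x ≤ x
    ≤-trans    : ∀ {x y z} → x ≤ y → y ≤ z → x ≤ z
    ≤-antisym  : ∀ {x y} → x ≤ y → y ≤ x → x ≈ y
    ≤-total    : ∀ x y → (x ≤ y) ⊎′ (y ≤ x)
    +-mono-≤   : ∀ {x y} z → x ≤ y → (x + z) ≤ (y + z)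
    *-nonneg   : ∀ {x y} → 0# ≤ x → 0# ≤ y → 0# ≤ (x * y)
    complete : (P : Carrier → Set) → Σ Carrier P →
               Σ Carrier (λ b → ∀ x → P x → x ≤ b) →
               Σ Carrier (λ s → (∀ x → P x → x ≤ s) ×
                                (∀ b → (∀ x → P x → x ≤ b) → s ≤ b))

  infix 4 _≤_ _<_
  _<_ : Carrier → Carrier → Set
  x < y = (x ≤ y) × ¬ (x ≈ y)

  _^ᴺ_ : Carrier → ℕ → Carrier
  x ^ᴺ zero  = 1#
  x ^ᴺ suc n = x * (x ^ᴺ n)

  prodᴺ : ℕ → (ℕ → Carrier) → Carrier
  prodᴺ zero    g = 1#
  prodᴺ (suc n) g = prodᴺ n g * g n

  -- y = x^{1/m}, i.e. y is the nonnegative real with y^m = x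
  IsRoot : ℕ → Carrier → Carrier → Set
  IsRoot m x y = (0# ≤ y) × (y ^ᴺ m ≈ x)

-- Put m = k + 1.  f vanishes exactly on [1 - k, 1], and the window x, …, x + k of every
-- such x contains 1, so r 1 = 0 makes all of their products vanish at once.
-- The remaining windows lie in [2, ∞) or in (-∞, 0], and on each half-line it suffices to
-- solve  ∏_{i ≤ k} s (n + i) = g n  for a positive sequence g.  Taking s 0 = g 0,
-- s 1 = … = s k = 1 and  s (n + m) = s n · g (n + 1) / g n,  sliding the window one step
-- multiplies its product by g (n + 1) / g n.  On the left half-line the windows are read
-- backwards, which commutativity absorbs.
module Submission where

open import Defs
open import Data.Nat using (ℕ; zero; suc)
open import Data.Product using (Σ; _×_; _,_; proj₁; proj₂)
open import Relation.Nullary using (¬_; yes; no)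
open import Function using (_∘_)
open import Data.Empty using (⊥-elim)
open import Data.Sum using (inj₁; inj₂)
open import Relation.Binary.PropositionalEquality as ≡ using (_≡_)
open import Algebra.Bundles using (CommutativeMonoid)
import Data.Nat as ℕ
import Data.Nat.Properties as ℕ
import Data.Nat.DivMod as ℕ
import Data.Integer as ℤ
import Data.Integer.Properties as ℤ

module SlidingWindow {c ℓ} (M : CommutativeMonoid c ℓ) where

  open CommutativeMonoid M
  open import Data.Nat using (_+_; _*_; _∸_; _<_)
  open import Data.Nat.DivMod using (_%_; _/_)
  open import Algebra.Definitions _≈_ using (Zero)
  open import Algebra.Properties.CommutativeSemigroup commutativeSemigroup
    using (x∙yz≈yx∙z)
  open import Relation.Binary.Reasoning.Setoid setoid

  ∏ : ℕ → (ℕ → Carrier) → Carrier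
  ∏ zero    g = ε
  ∏ (suc n) g = ∏ n g ∙ g n

  ∏-cong : ∀ n {g h : ℕ → Carrier} → (∀ i → i < n → g i ≈ h i) → ∏ n g ≈ ∏ n h
  ∏-cong zero    g≈h = refl
  ∏-cong (suc n) g≈h =
    ∙-cong (∏-cong n (λ i i<n → g≈h i (ℕ.m<n⇒m<1+n i<n))) (g≈h n ℕ.≤-refl)

  ∏-ε : ∀ n → ∏ n (λ _ → ε) ≈ ε
  ∏-ε zero    = refl
  ∏-ε (suc n) = trans (identityʳ _) (∏-ε n)

  ∏-head-tail : ∀ n (g : ℕ → Carrier) → ∏ (suc n) g ≈ g 0 ∙ ∏ n (g ∘ suc)
  ∏-head-tail zero    g = comm ε (g 0)
  ∏-head-tail (suc n) g = begin
    ∏ (suc n) g ∙ g (suc n)            ≈⟨ ∙-congʳ (∏-head-tail n g) ⟩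
    (g 0 ∙ ∏ n (g ∘ suc)) ∙ g (suc n)  ≈⟨ assoc _ _ _ ⟩
    g 0 ∙ ∏ (suc n) (g ∘ suc)          ∎

  ∏-reverse : ∀ k (g : ℕ → Carrier) → ∏ (suc k) (λ i → g (k ∸ i)) ≈ ∏ (suc k) g
  ∏-reverse zero    g = refl
  ∏-reverse (suc k) g = begin
    ∏ (suc (suc k)) (λ i → g (suc k ∸ i))  ≈⟨ ∏-head-tail (suc k) _ ⟩
    g (suc k) ∙ ∏ (suc k) (λ i → g (k ∸ i))  ≈⟨ ∙-congˡ (∏-reverse k g) ⟩
    g (suc k) ∙ ∏ (suc k) g                  ≈⟨ comm _ _ ⟩
    ∏ (suc (suc k)) g                        ∎

  ∏-zero : ∀ {z} → Zero z _∙_ → ∀ n (g : ℕ → Carrier) {i} → i < n → g i ≈ z → ∏ n g ≈ z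
  ∏-zero z-zero@(zeroˡ , zeroʳ) (suc n) g i<1+n gi≈z with ℕ.m<1+n⇒m<n∨m≡n i<1+n
  ... | inj₁ i<n    = trans (∙-congʳ (∏-zero z-zero n g i<n gi≈z)) (zeroˡ (g n))
  ... | inj₂ ≡.refl = trans (∙-congˡ gi≈z) (zeroʳ (∏ n g))

  ∏-slide : ∀ k {s : ℕ → Carrier} {q} → s (suc k) ≈ s 0 ∙ q →
            ∏ (suc k) (s ∘ suc) ≈ ∏ (suc k) s ∙ q
  ∏-slide k {s} {q} s-step = begin
    ∏ k (s ∘ suc) ∙ s (suc k)  ≈⟨ ∙-congˡ s-step ⟩
    ∏ k (s ∘ suc) ∙ (s 0 ∙ q)  ≈⟨ x∙yz≈yx∙z _ _ _ ⟩
    (s 0 ∙ ∏ k (s ∘ suc)) ∙ q  ≈⟨ ∙-congʳ (∏-head-tail k s) ⟨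
    ∏ (suc k) s ∙ q            ∎

  sliding-window : ∀ k (s g q : ℕ → Carrier) →
                   (∀ n → s (n + suc k) ≈ s n ∙ q n) →
                   (∀ n → g n ∙ q n ≈ g (suc n)) →
                   ∏ (suc k) s ≈ g 0 →
                   ∀ n → ∏ (suc k) (λ i → s (n + i)) ≈ g n
  sliding-window k s g q s-step g-step init zero    = init
  sliding-window k s g q s-step g-step init (suc n) =
    sliding-window k (s ∘ suc) (g ∘ suc) (q ∘ suc) (s-step ∘ suc) (g-step ∘ suc) init′ n
    where
    init′ : ∏ (suc k) (s ∘ suc) ≈ g 1
    init′ = begin
      ∏ (suc k) (s ∘ suc)  ≈⟨ ∏-slide k (s-step 0) ⟩
      ∏ (suc k) s ∙ q 0    ≈⟨ ∙-congʳ init ⟩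
      g 0 ∙ q 0            ≈⟨ g-step 0 ⟩
      g 1                  ∎

  impulse : Carrier → ℕ → Carrier
  impulse x zero    = x
  impulse x (suc _) = ε

  ∏-impulse : ∀ n x → ∏ (suc n) (impulse x) ≈ x
  ∏-impulse n x = begin
    ∏ (suc n) (impulse x)  ≈⟨ ∏-head-tail n (impulse x) ⟩
    x ∙ ∏ n (λ _ → ε)      ≈⟨ ∙-congˡ (∏-ε n) ⟩
    x ∙ ε                  ≈⟨ identityʳ x ⟩
    x                      ∎

  module _ (k : ℕ) (a q : ℕ → Carrier) where

    private
      -- lagged′ i j is the value of lagged at i + j * suc k.
      lagged′ : ℕ → ℕ → Carrier
      lagged′ i zero    = a i
      lagged′ i (suc j) = lagged′ i j ∙ q (i + j * suc k)

    lagged : ℕ → Carrier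
    lagged n = lagged′ (n % suc k) (n / suc k)

    lagged-< : ∀ {i} → i < suc k → lagged i ≡ a i
    lagged-< i<1+k = ≡.cong₂ lagged′ (ℕ.m<n⇒m%n≡m i<1+k) (ℕ.m<n⇒m/n≡0 i<1+k)

    lagged-+ : ∀ n → lagged (n + suc k) ≡ lagged n ∙ q n
    lagged-+ n =
      ≡.trans (≡.cong₂ lagged′ (ℕ.[m+n]%n≡m%n n (suc k)) [n+1+k]/[1+k]≡1+n/[1+k])
              (≡.cong (λ i → lagged n ∙ q i) (≡.sym (ℕ.m≡m%n+[m/n]*n n (suc k))))
      where
      [n+1+k]/[1+k]≡1+n/[1+k] : (n + suc k) / suc k ≡ suc (n / suc k)
      [n+1+k]/[1+k]≡1+n/[1+k] =
        ≡.trans (ℕ.m/n≡1+[m∸n]/n (ℕ.m≤n+m (suc k) n))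
                (≡.cong (suc ∘ (_/ suc k)) (ℕ.m+n∸n≡m n (suc k)))

    lagged-closed : ∀ {p} (P : Carrier → Set p) → (∀ {x y} → P x → P y → P (x ∙ y)) →
                    (∀ i → P (a i)) → (∀ n → P (q n)) → ∀ n → P (lagged n)
    lagged-closed P ∙-closed Pa Pq n = closed (n % suc k) (n / suc k)
      where
      closed : ∀ i j → P (lagged′ i j)
      closed i zero    = Pa i
      closed i (suc j) = ∙-closed (closed i j) (Pq _)

  lagged-window : ∀ k {g q : ℕ → Carrier} → (∀ n → g n ∙ q n ≈ g (suc n)) →
                  ∀ n → ∏ (suc k) (λ i → lagged k (impulse (g 0)) q (n + i)) ≈ g n
  lagged-window k {g} {q} g-step =
    sliding-window k s g q (reflexive ∘ lagged-+ k _ q) g-step init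
    where
    s : ℕ → Carrier
    s = lagged k (impulse (g 0)) q
    init : ∏ (suc k) s ≈ g 0
    init = trans (∏-cong (suc k) (λ i i<1+k → reflexive (lagged-< k _ q i<1+k)))
                 (∏-impulse k (g 0))

module RealFieldProperties (R : RealField) where

  open RealField R hiding (zero)
  open import Algebra.Properties.Ring ring using (-1*x≈-x; -‿distribʳ-*)
  open import Algebra.Properties.AbelianGroup +-abelianGroup using (⁻¹-involutive)
  open import Algebra.Properties.CommutativeSemigroup *-commutativeSemigroup
    using (xy∙z≈y∙xz)
  open import Relation.Binary.Reasoning.Setoid setoid
  open SlidingWindow *-commutativeMonoid using (∏; impulse; lagged; lagged-closed; lagged-window)

  x≤0⇒0≤-x : ∀ {x} → x ≤ 0# → 0# ≤ - x
  x≤0⇒0≤-x {x} x≤0 = ≤-resp-≈ (-‿inverseʳ x) (+-identityˡ (- x)) (+-mono-≤ (- x) x≤0)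

  0≤-x⇒x≤0 : ∀ {x} → 0# ≤ - x → x ≤ 0#
  0≤-x⇒x≤0 {x} 0≤-x = ≤-resp-≈ (+-identityˡ x) (-‿inverseˡ x) (+-mono-≤ x 0≤-x)

  0≤1 : 0# ≤ 1#
  0≤1 with ≤-total 0# 1#
  ... | inj₁ 0≤1 = 0≤1
  ... | inj₂ 1≤0 = ≤-resp-≈ refl -1*-1≈1 (*-nonneg 0≤-1 0≤-1)
    where
    0≤-1 : 0# ≤ - 1#
    0≤-1 = x≤0⇒0≤-x 1≤0
    -1*-1≈1 : - 1# * - 1# ≈ 1#
    -1*-1≈1 = trans (-1*x≈-x (- 1#)) (⁻¹-involutive 1#)

  0<1 : 0# < 1#
  0<1 = 0≤1 , 0≉1

  inverse-nonneg : ∀ {x y} → 0# ≤ x → x * y ≈ 1# → 0# ≤ y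
  inverse-nonneg {x} {y} 0≤x xy≈1 with ≤-total 0# y
  ... | inj₁ 0≤y = 0≤y
  ... | inj₂ y≤0 = ⊥-elim (0≉1 (≤-antisym 0≤1 (0≤-x⇒x≤0 0≤-1)))
    where
    0≤-1 : 0# ≤ - 1#
    0≤-1 = ≤-resp-≈ refl (trans (sym (-‿distribʳ-* x y)) (-‿cong xy≈1))
                    (*-nonneg 0≤x (x≤0⇒0≤-x y≤0))

  *-pos : ∀ {x y} → 0# < x → 0# < y → 0# < x * y
  *-pos {x} {y} (0≤x , 0≉x) (0≤y , 0≉y) = *-nonneg 0≤x 0≤y , 0≉xy
    where
    0≉xy : ¬ (0# ≈ x * y)
    0≉xy 0≈xy with inverse x (0≉x ∘ sym)
    ... | x⁻¹ , xx⁻¹≈1 = 0≉y (sym (begin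
      y              ≈⟨ *-identityˡ y ⟨
      1# * y         ≈⟨ *-congʳ xx⁻¹≈1 ⟨
      (x * x⁻¹) * y  ≈⟨ xy∙z≈y∙xz x x⁻¹ y ⟩
      x⁻¹ * (x * y)  ≈⟨ *-congˡ 0≈xy ⟨
      x⁻¹ * 0#       ≈⟨ zeroʳ x⁻¹ ⟩
      0#             ∎))

  ^ᴺ-pos : ∀ {x} n → 0# < x → 0# < x ^ᴺ n
  ^ᴺ-pos zero    0<x = 0<1
  ^ᴺ-pos (suc n) 0<x = *-pos 0<x (^ᴺ-pos n 0<x)

  ^ᴺ-zero : ∀ {x} n → x ≈ 0# → x ^ᴺ suc n ≈ 0#
  ^ᴺ-zero n x≈0 = trans (*-congʳ x≈0) (zeroˡ _)

  prodᴺ≡∏ : ∀ n g → prodᴺ n g ≡ ∏ n g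
  prodᴺ≡∏ zero    g = ≡.refl
  prodᴺ≡∏ (suc n) g = ≡.cong (_* g n) (prodᴺ≡∏ n g)

  window-root : ∀ k (g : ℕ → Carrier) → (∀ n → 0# < g n) →
                Σ (ℕ → Carrier) λ s → (∀ n → 0# ≤ s n) ×
                                      (∀ n → ∏ (suc k) (λ i → s (n ℕ.+ i)) ≈ g n)
  window-root k g 0<g = s , s-nonneg , lagged-window k g-step
    where
    g⁻¹ : ℕ → Carrier
    g⁻¹ n = proj₁ (inverse (g n) (proj₂ (0<g n) ∘ sym))
    gg⁻¹≈1 : ∀ n → g n * g⁻¹ n ≈ 1#
    gg⁻¹≈1 n = proj₂ (inverse (g n) (proj₂ (0<g n) ∘ sym))
    ratio : ℕ → Carrier
    ratio n = g⁻¹ n * g (suc n)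
    g-step : ∀ n → g n * ratio n ≈ g (suc n)
    g-step n = begin
      g n * (g⁻¹ n * g (suc n))  ≈⟨ *-assoc _ _ _ ⟨
      (g n * g⁻¹ n) * g (suc n)  ≈⟨ *-congʳ (gg⁻¹≈1 n) ⟩
      1# * g (suc n)             ≈⟨ *-identityˡ _ ⟩
      g (suc n)                  ∎
    s : ℕ → Carrier
    s = lagged k (impulse (g 0)) ratio
    impulse-nonneg : ∀ i → 0# ≤ impulse (g 0) i
    impulse-nonneg zero    = proj₁ (0<g 0)
    impulse-nonneg (suc i) = 0≤1
    ratio-nonneg : ∀ n → 0# ≤ ratio n
    ratio-nonneg n =
      *-nonneg (inverse-nonneg (proj₁ (0<g n)) (gg⁻¹≈1 n)) (proj₁ (0<g (suc n)))
    s-nonneg : ∀ n → 0# ≤ s n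
    s-nonneg = lagged-closed k _ ratio (0# ≤_) *-nonneg impulse-nonneg ratio-nonneg

open import Data.Integer using (ℤ; +_; _+_; _-_; _≤_)

splice : ∀ {a} {A : Set a} → (ℕ → A) → A → (ℕ → A) → ℤ → A
splice s c t (+ suc (suc n)) = s n
splice s c t (+ 1)           = c
splice s c t (+ 0)           = t 0
splice s c t ℤ.-[1+ n ]      = t (suc n)

splice-neg : ∀ {a} {A : Set a} (s : ℕ → A) c t j → splice s c t (ℤ.- + j) ≡ t j
splice-neg s c t zero    = ≡.refl
splice-neg s c t (suc j) = ≡.refl

splice-closed : ∀ {a p} {A : Set a} (P : A → Set p) {s c t} →
                (∀ n → P (s n)) → P c → (∀ n → P (t n)) → ∀ x → P (splice s c t x)
splice-closed P Ps Pc Pt (+ suc (suc n)) = Ps n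
splice-closed P Ps Pc Pt (+ 1)           = Pc
splice-closed P Ps Pc Pt (+ 0)           = Pt 0
splice-closed P Ps Pc Pt ℤ.-[1+ n ]      = Pt (suc n)

-j≡2⊖[2+j] : ∀ j → ℤ.- + j ≡ 2 ℤ.⊖ (2 ℕ.+ j)
-j≡2⊖[2+j] j = ≡.sym (≡.trans (ℤ.[1+m]⊖[1+n]≡m⊖n 1 (suc j))
                     (≡.trans (ℤ.[1+m]⊖[1+n]≡m⊖n 0 j) (ℤ.⊖-≤ ℕ.z≤n)))

2-[1+k]≤-j : ∀ {j k} → j ℕ.< k → + 2 - + suc k ≤ ℤ.- + j
2-[1+k]≤-j {j} j<k =
  ≡.subst (_ ≤_) (≡.sym (-j≡2⊖[2+j] j)) (ℤ.⊖-monoʳ-≥-≤ 2 (ℕ.s≤s j<k))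

-j<2-[1+k] : ∀ {j k} → k ℕ.≤ j → ℤ.- + j ℤ.< + 2 - + suc k
-j<2-[1+k] {j} k≤j =
  ≡.subst (ℤ._< _) (≡.sym (-j≡2⊖[2+j] j)) (ℤ.⊖-monoʳ->-< 2 (ℕ.s≤s (ℕ.s≤s k≤j)))

-j+[1+j]≡1 : ∀ j → ℤ.- + j + + suc j ≡ + 1
-j+[1+j]≡1 j =
  ≡.trans (ℤ.-m+n≡n⊖m j (suc j))
          (≡.trans (ℤ.≤-⊖ (ℕ.n≤1+n j)) (≡.cong +_ (ℕ.m+n∸n≡m 1 j)))

-[n+k]+i≡-[n+[k∸i]] : ∀ n {k i} → i ℕ.≤ k → ℤ.- + (n ℕ.+ k) + + i ≡ ℤ.- + (n ℕ.+ (k ℕ.∸ i))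
-[n+k]+i≡-[n+[k∸i]] n {k} i≤k =
  ≡.trans (ℤ.-m+n≡n⊖m (n ℕ.+ k) _)
          (≡.trans (ℤ.⊖-≤ (ℕ.≤-trans i≤k (ℕ.m≤n+m k n)))
                   (≡.cong (ℤ.-_ ∘ +_) (ℕ.+-∸-assoc n i≤k)))

module _ (R : RealField) where

  open RealField R
    using ( Carrier; 0#; _≈_; _^ᴺ_; prodᴺ; IsRoot; sym; trans; reflexive; setoid
          ; *-commutativeMonoid)
    renaming (_≤_ to _≤ᴿ_; zero to *-zero)
  open RealFieldProperties R using (^ᴺ-zero; prodᴺ≡∏)
  open SlidingWindow *-commutativeMonoid using (∏; ∏-cong; ∏-reverse; ∏-zero)
  open import Relation.Binary.Reasoning.Setoid setoid

  splice-isRoot : ∀ k (f : ℤ → Carrier) {s t : ℕ → Carrier} →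
    (∀ x → 0# ≤ᴿ f x) →
    f (+ 1) ≈ 0# →
    (∀ x → + 2 - + suc k ≤ x → x ≤ + 1 → f x ≈ 0#) →
    (∀ n → ∏ (suc k) (λ i → s (n ℕ.+ i)) ≈ f (+ (2 ℕ.+ n)) ^ᴺ suc k) →
    (∀ n → ∏ (suc k) (λ i → t (n ℕ.+ i)) ≈ f (ℤ.- + (n ℕ.+ k)) ^ᴺ suc k) →
    ∀ x → IsRoot (suc k) (prodᴺ (suc k) (λ i → splice s 0# t (x + + i))) (f x)
  splice-isRoot k f {s} {t} 0≤f f1≈0 f-zero s-window t-window x =
    0≤f x , trans (window x) (reflexive (≡.sym (prodᴺ≡∏ (suc k) _)))
    where
    r : ℤ → Carrier
    r = splice s 0# t

    Window : ℤ → Set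
    Window x = f x ^ᴺ suc k ≈ ∏ (suc k) (λ i → r (x + + i))

    vanishing : ∀ {x j} → j ℕ.< suc k → x + + j ≡ + 1 → f x ≈ 0# → Window x
    vanishing j<1+k x+j≡1 fx≈0 = trans (^ᴺ-zero k fx≈0)
      (sym (∏-zero *-zero (suc k) _ j<1+k (reflexive (≡.cong r x+j≡1))))

    below-zeros : ∀ n → Window (ℤ.- + (n ℕ.+ k))
    below-zeros n = begin
      f (ℤ.- + (n ℕ.+ k)) ^ᴺ suc k                ≈⟨ t-window n ⟨
      ∏ (suc k) (λ i → t (n ℕ.+ i))               ≈⟨ ∏-reverse k _ ⟨
      ∏ (suc k) (λ i → t (n ℕ.+ (k ℕ.∸ i)))       ≈⟨ ∏-cong (suc k) reindex ⟩
      ∏ (suc k) (λ i → r (ℤ.- + (n ℕ.+ k) + + i))  ∎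
      where
      reindex : ∀ i → i ℕ.< suc k → t (n ℕ.+ (k ℕ.∸ i)) ≈ r (ℤ.- + (n ℕ.+ k) + + i)
      reindex i i<1+k = reflexive (≡.sym (≡.trans
        (≡.cong r (-[n+k]+i≡-[n+[k∸i]] n (ℕ.m<1+n⇒m≤n i<1+k))) (splice-neg s 0# t _)))

    nonpositive : ∀ j → Window (ℤ.- + j)
    nonpositive j with j ℕ.<? k
    ... | yes j<k =
      vanishing (ℕ.s≤s j<k) (-j+[1+j]≡1 j) (f-zero _ (2-[1+k]≤-j j<k) ℤ.neg-≤-pos)
    ... | no j≮k  =
      ≡.subst (Window ∘ ℤ.-_ ∘ +_) (ℕ.m∸n+n≡m (ℕ.≮⇒≥ j≮k)) (below-zeros (j ℕ.∸ k))

    window : ∀ x → Window x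
    window (+ suc (suc n)) = sym (s-window n)
    window (+ 1)           = vanishing (ℕ.s≤s ℕ.z≤n) ≡.refl f1≈0
    window (+ 0)           = nonpositive 0
    window ℤ.-[1+ n ]      = nonpositive (suc n)

proposition3p8 : (R : RealField) → (m : ℕ) → (f : ℤ → RealField.Carrier R) →
    (∀ x → RealField._≤_ R (RealField.0# R) (f x)) →
    RealField._≈_ R (f (+ 1)) (RealField.0# R) →
    (∀ x → (+ 2 - + m) ≤ x → x ≤ + 1 → RealField._≈_ R (f x) (RealField.0# R)) →
    (∀ x → ¬ ((+ 2 - + m) ≤ x × x ≤ + 1) → RealField._<_ R (RealField.0# R) (f x)) →
    Σ (ℤ → RealField.Carrier R) (λ r →
      (∀ x → RealField._≤_ R (RealField.0# R) (r x)) ×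
      RealField._≈_ R (r (+ 1)) (RealField.0# R) ×
      (∀ x → RealField.IsRoot R m (RealField.prodᴺ R m (λ i → r (x + + i))) (f x)))
proposition3p8 R zero f _ f1≈0 _ 0<f =
  ⊥-elim (proj₂ (0<f (+ 1) λ { (ℤ.+≤+ (ℕ.s≤s ()) , _) }) (RealField.sym R f1≈0))
proposition3p8 R (suc k) f 0≤f f1≈0 f-zero 0<f =
  let (s , 0≤s , s-window) = window-root k (λ n → f (+ (2 ℕ.+ n)) ^ᴺ suc k) right-pos
      (t , 0≤t , t-window) = window-root k (λ n → f (ℤ.- + (n ℕ.+ k)) ^ᴺ suc k) left-pos
  in splice s 0# t , splice-closed (0# ≤ᴿ_) 0≤s ≤-refl 0≤t , refl ,
     splice-isRoot R k f 0≤f f1≈0 f-zero s-window t-window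
  where
  open RealField R using (0#; _^ᴺ_; refl; ≤-refl) renaming (_≤_ to _≤ᴿ_; _<_ to _<ᴿ_)
  open RealFieldProperties R using (window-root; ^ᴺ-pos)

  right-pos : ∀ n → 0# <ᴿ f (+ (2 ℕ.+ n)) ^ᴺ suc k
  right-pos n = ^ᴺ-pos (suc k) (0<f _ λ { (_ , ℤ.+≤+ (ℕ.s≤s ())) })

  left-pos : ∀ n → 0# <ᴿ f (ℤ.- + (n ℕ.+ k)) ^ᴺ suc k
  left-pos n = ^ᴺ-pos (suc k) (0<f _ (ℤ.<⇒≱ (-j<2-[1+k] (ℕ.m≤n+m k n)) ∘ proj₁))
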